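{- Let $\Lambda_h=\begin{bmatrix}1&-\frac12\\0&\frac{\sqrt3}{2}\end{bmatrix}\mathbb{Z}^2$. Suppose $J\in\mathbb{Z}_{>0}$ is not of the form $$J=3^k\prod_{p_i\equiv1\ (\mathrm{mod}\ 3)}p_i^{l_i}\prod_{q_j\equiv-1\ (\mathrm{mod}\ 3)}q_j^{2m_j}\qquad(k,l_i,m_j\in\mathbb{Z}_{\ge0},\ p_i,q_j\text{ primes}),$$ and that one of the following holds: (1) $J$ is prime; (2) $J=pq$ with $p,q$ odd primes and $q>3p$; (3) $J=2p$ with $p$ an odd prime. Then $\Lambda_h$ has no well-rounded sublattice of index $J$.
   Context: For a lattice $\Gamma\subset\mathbb{R}^2$, $|\Gamma|=\min\{\|y\|^2:y\in\Gamma\setminus\{0\}\}$; $\Gamma$ is well-rounded if it has a basis consisting of two vectors attaining this minimum. The index of a sublattice $\Gamma\subseteq\Lambda_h$ is $\det\Gamma/\det\Lambda_h$. -}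

module Defs where

open import Data.Nat as ℕ using (ℕ; _%_; _^_)
open import Data.Nat.Primality using (Prime)
open import Data.Integer as ℤ using (ℤ; _+_; _-_; _*_; ∣_∣)
open import Data.List using (List)
open import Data.Nat.ListAction using (product)
open import Data.Sum using (_⊎_)
open import Data.List.Relation.Unary.All using (All)
open import Data.Product using (Σ; ∃; ∃-syntax; _×_; _,_)
open import Relation.Binary.PropositionalEquality using (_≡_; _≢_)
open import Relation.Nullary using (¬_)

-- Points of Λ_h = B ℤ², B = [[1, -1/2], [0, √3/2]], are written in
-- coordinates w.r.t. the basis B : the pair (a , b) stands for B (a , b)ᵀ.
Pt : Set
Pt = ℤ × ℤ

-- ‖B (a , b)ᵀ‖² = (a - b/2)² + 3b²/4 = a² - ab + b²  (an integer).
normSq : Pt → ℤ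
normSq (a , b) = a * a - a * b + b * b

zeroPt : Pt
zeroPt = (ℤ.+ 0 , ℤ.+ 0)

lin : ℤ → ℤ → Pt → Pt → Pt
lin x y (u₁ , u₂) (v₁ , v₂) = (x * u₁ + y * v₁ , x * u₂ + y * v₂)

det₂ : Pt → Pt → ℤ
det₂ (u₁ , u₂) (v₁ , v₂) = u₁ * v₂ - u₂ * v₁

record Sublattice : Set where
  constructor sublattice
  field
    b₁ b₂   : Pt
    indep   : det₂ b₁ b₂ ≢ ℤ.+ 0

open Sublattice public

_∈Γ_ : Pt → Sublattice → Set
w ∈Γ Γ = ∃[ x ] ∃[ y ] (w ≡ lin x y (b₁ Γ) (b₂ Γ))

-- index [Λ_h : Γ] = det Γ / det Λ_h = |det of coordinate matrix|
index : Sublattice → ℕ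
index Γ = ∣ det₂ (b₁ Γ) (b₂ Γ) ∣

IsMinNorm : Sublattice → ℤ → Set
IsMinNorm Γ m =
  (∃[ w ] (w ∈Γ Γ × w ≢ zeroPt × normSq w ≡ m)) ×
  (∀ w → w ∈Γ Γ → w ≢ zeroPt → m ℤ.≤ normSq w)

IsBasisOf : Pt → Pt → Sublattice → Set
IsBasisOf c₁ c₂ Γ =
  c₁ ∈Γ Γ × c₂ ∈Γ Γ × det₂ c₁ c₂ ≢ ℤ.+ 0 ×
  (∀ w → w ∈Γ Γ → ∃[ x ] ∃[ y ] (w ≡ lin x y c₁ c₂))

WellRounded : Sublattice → Set
WellRounded Γ = ∃[ c₁ ] ∃[ c₂ ]
  (IsBasisOf c₁ c₂ Γ × normSq c₁ ≡ normSq c₂ × IsMinNorm Γ (normSq c₁))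

-- J = 3^k ∏ p_i^{l_i} ∏ q_j^{2 m_j}, p_i ≡ 1, q_j ≡ -1 (mod 3) primes
-- (repeated entries in the lists account for the exponents)
NormForm : ℕ → Set
NormForm J = ∃[ k ] ∃[ ps ] ∃[ qs ]
  (All (λ p → Prime p × p % 3 ≡ 1) ps ×
   All (λ q → Prime q × q % 3 ≡ 2) qs ×
   J ≡ 3 ^ k ℕ.* product ps ℕ.* (product qs ℕ.* product qs))

OddPrime : ℕ → Set
OddPrime p = Prime p × p % 2 ≡ 1

CaseHyp : ℕ → Set
CaseHyp J =
  Prime J
  ⊎ (∃[ p ] ∃[ q ] (OddPrime p × OddPrime q × 3 ℕ.* p ℕ.< q × J ≡ p ℕ.* q))
  ⊎ (∃[ p ] (OddPrime p × J ≡ 2 ℕ.* p))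

-- Let c₁ , c₂ be a minimal basis of a well-rounded Γ ⊆ Λ_h with |Γ| = m and index J.
-- The diagonals c₁ ∓ c₂ are nonzero vectors of Γ, so their squared lengths u , v are at
-- least m, while the parallelogram law and |c₁|² = |c₂|² give u + v = 4m and u v = 3J².
-- Under each of the three case hypotheses this arithmetic forces m = J, so J = a² - ab + b²
-- is a norm of Λ_h.  Norms are never ≡ 2 (mod 3), and a prime q ≡ 2 (mod 3) dividing a
-- norm divides both coordinates (Fermat's little theorem), so q² divides the norm; hence J
-- would have the excluded normal form.
module Submission where

open import Defs
open import Data.Nat using (ℕ; _<_)
open import Relation.Binary.PropositionalEquality using (_≡_)
open import Relation.Nullary using (¬_)

module FermatLittle where

  open import Algebra.Bundles using (Semiring)
  open import Data.Fin using (zero; suc; toℕ; fromℕ; inject₁)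
  open import Data.Fin.Properties using (toℕ-fromℕ; toℕ-inject₁; toℕ<n)
  open import Data.Nat
  open import Data.Nat.Combinatorics using (_C_; nCk≡n!/k![n-k]!; k![n∸k]!∣n!; nCn≡1)
  open import Data.Nat.Divisibility
  open import Data.Nat.DivMod using (_/_; m/n*n≡m)
  open import Data.Nat.Primality using (Prime; euclidsLemma; prime⇒nonZero; ¬prime[1])
  open import Data.Nat.Properties
  open import Data.Nat.Tactic.RingSolver using (solve-∀)
  open import Data.Product using (∃-syntax; _,_)
  open import Data.Sum using (inj₁; inj₂)
  open import Data.Vec.Functional using (Vector; init)
  open import Relation.Binary.PropositionalEquality
  open import Relation.Nullary using (contradiction)

  open import Algebra.Definitions.RawSemiring (Semiring.rawSemiring +-*-semiring)
    using () renaming (_^_ to _^′_; _×_ to _×′_)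
  open import Algebra.Properties.Semiring.Sum +-*-semiring using (sum; sum-init-last)
  import Algebra.Properties.Semiring.Binomial +-*-semiring as Binomial

  ×′≗* : ∀ n x → n ×′ x ≡ n * x
  ×′≗* zero    x = refl
  ×′≗* (suc n) x = cong (x +_) (×′≗* n x)

  ^′≗^ : ∀ x n → x ^′ n ≡ x ^ n
  ^′≗^ x zero    = refl
  ^′≗^ x (suc n) = cong (x *_) (^′≗^ x n)

  prime∤! : ∀ {p} → Prime p → ∀ {j} → j < p → ¬ p ∣ j !
  prime∤! pr {zero}  j<p p∣1 = ¬prime[1] (subst Prime (∣1⇒≡1 p∣1) pr)
  prime∤! pr {suc j} j<p p∣j! with euclidsLemma (suc j) (j !) pr p∣j!
  ... | inj₁ p∣1+j = <⇒≱ j<p (∣⇒≤ p∣1+j)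
  ... | inj₂ p∣j!  = prime∤! pr (<-trans (n<1+n j) j<p) p∣j!

  prime∣C : ∀ {p k} → Prime p → 0 < k → k < p → p ∣ p C k
  prime∣C {p} {k} pr 0<k k<p with euclidsLemma (p C k) (k ! * (p ∸ k) !) pr p∣C*k!*[p∸k]!
    where
    instance _ = prime⇒nonZero pr
    instance _ = m*n≢0 (k !) ((p ∸ k) !) ⦃ k !≢0 ⦄ ⦃ (p ∸ k) !≢0 ⦄
    p!≡C*k!*[p∸k]! : p ! ≡ (p C k) * (k ! * (p ∸ k) !)
    p!≡C*k!*[p∸k]! = begin
      p !                                         ≡⟨ m/n*n≡m (k![n∸k]!∣n! (<⇒≤ k<p)) ⟨
      p ! / (k ! * (p ∸ k) !) * (k ! * (p ∸ k) !) ≡⟨ cong (_* (k ! * (p ∸ k) !)) (nCk≡n!/k![n-k]! (<⇒≤ k<p)) ⟨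
      (p C k) * (k ! * (p ∸ k) !)                 ∎
      where open ≡-Reasoning
    n∣n! : ∀ n → .{{NonZero n}} → n ∣ n !
    n∣n! (suc n) = m∣m*n (n !)
    p∣C*k!*[p∸k]! : p ∣ (p C k) * (k ! * (p ∸ k) !)
    p∣C*k!*[p∸k]! = subst (p ∣_) p!≡C*k!*[p∸k]! (n∣n! p)
  ... | inj₁ p∣C = p∣C
  ... | inj₂ p∣k!*[p∸k]! with euclidsLemma (k !) ((p ∸ k) !) pr p∣k!*[p∸k]!
  ...   | inj₁ p∣k!     = contradiction p∣k! (prime∤! pr k<p)
  ...   | inj₂ p∣[p∸k]! = contradiction p∣[p∸k]! (prime∤! pr (∸-monoʳ-< 0<k (<⇒≤ k<p)))

  ∣-sum : ∀ {d n} (f : Vector ℕ n) → (∀ i → d ∣ f i) → d ∣ sum f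
  ∣-sum {d} {zero}  f d∣f = d ∣0
  ∣-sum {n = suc n} f d∣f = ∣m∣n⇒∣m+n (d∣f zero) (∣-sum (λ i → f (suc i)) (λ i → d∣f (suc i)))

  freshman's-dream : ∀ {p} → Prime p → ∀ x → ∃[ M ] (x + 1) ^ p ≡ x ^ p + 1 + M * p
  freshman's-dream {p@(suc n)} pr x = quotient p∣inner , (begin
    (x + 1) ^ p                                    ≡⟨ ^′≗^ (x + 1) p ⟨
    (x + 1) ^′ p                                   ≡⟨ theorem (*-comm x 1) p ⟩
    term zero + sum (λ i → term (suc i))           ≡⟨ cong (term zero +_) (sum-init-last (λ i → term (suc i))) ⟩
    term zero + (sum inner + term (suc (fromℕ n))) ≡⟨ cong₂ (λ a b → a + (sum inner + b)) first-term last-term ⟩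
    1 + (sum inner + x ^ p)                        ≡⟨ cong (λ s → 1 + (s + x ^ p)) (_∣_.equality p∣inner) ⟩
    1 + (quotient p∣inner * p + x ^ p)             ≡⟨ rearrange (quotient p∣inner * p) (x ^ p) ⟩
    x ^ p + 1 + quotient p∣inner * p               ∎)
    where
    open ≡-Reasoning
    open Binomial x 1 using (theorem; binomial; binomialTerm)
    term = binomialTerm p
    inner : Vector ℕ n
    inner = init (λ i → term (suc i))
    first-term : term zero ≡ 1
    first-term = trans (×′≗* 1 _) (trans (*-identityˡ _) (trans (*-identityˡ _) (trans (^′≗^ 1 p) (^-zeroˡ p))))
    last-term : term (suc (fromℕ n)) ≡ x ^ p
    last-term = top-term (toℕ (suc (fromℕ n))) (cong suc (toℕ-fromℕ n))
      where
      top-term : ∀ k → k ≡ p → (p C k) ×′ (x ^′ k * 1 ^′ (p ∸ k)) ≡ x ^ p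
      top-term k refl rewrite nCn≡1 p | n∸n≡0 p =
        trans (×′≗* 1 _) (trans (*-identityˡ _) (trans (*-identityʳ _) (^′≗^ x p)))
    p∣inner : p ∣ sum inner
    p∣inner = ∣-sum inner λ i → let j = suc (inject₁ i) in
      subst (p ∣_) (sym (×′≗* (p C toℕ j) (binomial p j))) (∣m⇒∣m*n (binomial p j) (p∣C i))
      where
      p∣C : ∀ i → p ∣ p C toℕ (suc (inject₁ i))
      p∣C i rewrite toℕ-inject₁ i = prime∣C pr (s≤s z≤n) (s≤s (toℕ<n i))
    rearrange : ∀ a b → 1 + (a + b) ≡ b + 1 + a
    rearrange = solve-∀

  fermat-ℕ : ∀ {p} → Prime p → ∀ x → ∃[ t ] x ^ p ≡ x + t * p
  fermat-ℕ {suc n} pr zero    = 0 , refl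
  fermat-ℕ {p}     pr (suc x) with fermat-ℕ pr x | freshman's-dream pr x
  ... | t , x^p≡x+tp | M , [x+1]^p≡x^p+1+Mp = t + M , (begin
    suc x ^ p             ≡⟨ cong (_^ p) (+-comm 1 x) ⟩
    (x + 1) ^ p           ≡⟨ [x+1]^p≡x^p+1+Mp ⟩
    x ^ p + 1 + M * p     ≡⟨ cong (λ y → y + 1 + M * p) x^p≡x+tp ⟩
    x + t * p + 1 + M * p ≡⟨ rearrange x t M p ⟩
    suc x + (t + M) * p   ∎)
    where
    open ≡-Reasoning
    rearrange : ∀ x t M p → x + t * p + 1 + M * p ≡ suc x + (t + M) * p
    rearrange = solve-∀

module Congruence (n : ℕ) where

  import Data.Nat as ℕ
  open import Data.Integer
  open import Data.Integer.DivMod using (a≡a%ℕn+[a/ℕn]*n)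
  open import Data.Integer.Divisibility.Signed
  open import Data.Integer.Properties
  open import Data.Integer.Tactic.RingSolver using (solve-∀)
  open import Relation.Binary.Bundles using (Setoid)
  open import Relation.Binary.PropositionalEquality

  infix 4 _≈_
  record _≈_ (x y : ℤ) : Set where
    constructor mod
    field ∣-diff : + n ∣ x - y
  open _≈_ public

  private
    diff-neg : ∀ x y → - (x - y) ≡ y - x
    diff-neg = solve-∀
    diff-neg-cong : ∀ x y → - (x - y) ≡ - x - - y
    diff-neg-cong = solve-∀
    diff-* : ∀ x y u w → (x - y) * u + y * (u - w) ≡ x * u - y * w
    diff-* = solve-∀
    +-sub-cancelˡ : ∀ x y → x + y - x ≡ y
    +-sub-cancelˡ = solve-∀

  ≈-refl : ∀ {x} → x ≈ x
  ≈-refl {x} = mod (divides 0ℤ (trans (+-inverseʳ x) (sym (*-zeroˡ (+ n)))))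

  ≈-sym : ∀ {x y} → x ≈ y → y ≈ x
  ≈-sym {x} {y} (mod n∣x-y) = mod (subst (+ n ∣_) (diff-neg x y) (∣m⇒∣-m n∣x-y))

  ≈-trans : ∀ {x y z} → x ≈ y → y ≈ z → x ≈ z
  ≈-trans {x} {y} {z} (mod n∣x-y) (mod n∣y-z) =
    mod (subst (+ n ∣_) (+-minus-telescope x y z) (∣m∣n⇒∣m+n n∣x-y n∣y-z))

  -‿cong : ∀ {x y} → x ≈ y → - x ≈ - y
  -‿cong {x} {y} (mod n∣x-y) = mod (subst (+ n ∣_) (diff-neg-cong x y) (∣m⇒∣-m n∣x-y))

  *-cong : ∀ {x y u w} → x ≈ y → u ≈ w → x * u ≈ y * w
  *-cong {x} {y} {u} {w} (mod n∣x-y) (mod n∣u-w) =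
    mod (subst (+ n ∣_) (diff-* x y u w) (∣m∣n⇒∣m+n (∣m⇒∣m*n u n∣x-y) (∣n⇒∣m*n y n∣u-w)))

  ^-cong : ∀ {x y} → x ≈ y → ∀ k → x ^ k ≈ y ^ k
  ^-cong x≈y ℕ.zero    = ≈-refl
  ^-cong x≈y (ℕ.suc k) = *-cong x≈y (^-cong x≈y k)

  x+kn≈x : ∀ x k → x + k * + n ≈ x
  x+kn≈x x k = mod (divides k (+-sub-cancelˡ x (k * + n)))

  x≈x%ℕn : .{{_ : ℕ.NonZero n}} → ∀ x → x ≈ + (x %ℕ n)
  x≈x%ℕn x = subst (_≈ + (x %ℕ n)) (sym (a≡a%ℕn+[a/ℕn]*n x n)) (x+kn≈x (+ (x %ℕ n)) (x /ℕ n))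

  ≈-setoid : Setoid _ _
  ≈-setoid = record
    { Carrier       = ℤ
    ; _≈_           = _≈_
    ; isEquivalence = record { refl = ≈-refl ; sym = ≈-sym ; trans = ≈-trans }
    }

module Norm where

  open import Data.Integer hiding (∣_∣)
  import Data.Integer as ℤ
  open import Data.Integer.Divisibility.Signed
  open import Data.Integer.Properties
  open import Data.Integer.Tactic.RingSolver using (solve-∀)
  import Data.Nat as ℕ
  import Data.Nat.Divisibility as ℕ
  import Data.Nat.DivMod as ℕ
  import Data.Nat.Tactic.RingSolver as ℕ-Solver
  open import Data.Nat.Primality using (Prime; Composite; composite; prime; euclidsLemma; prime⇒nonZero; prime⇒irreducible)
  open import Data.Product using (∃-syntax; _,_; proj₁; proj₂)
  open import Data.Sum as Sum using (_⊎_; inj₁; inj₂; [_,_]′)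
  open import Function using (id; _∘_)
  open import Relation.Binary.PropositionalEquality
  open import Relation.Nullary using (contradiction)
  open import Relation.Nullary.Decidable using (from-no)
  open import Data.Integer.DivMod using (n%ℕd<d)
  open FermatLittle using (fermat-ℕ)

  IsNorm : ℕ → Set
  IsNorm n = ∃[ w ] + n ≡ normSq w

  +-^ : ∀ m k → + (m ℕ.^ k) ≡ (+ m) ^ k
  +-^ m ℕ.zero    = refl
  +-^ m (ℕ.suc k) = trans (pos-* m (m ℕ.^ k)) (cong (+ m *_) (+-^ m k))

  fermat : ∀ {p} → Prime p → ∀ z → let open Congruence p in z ^ p ≈ z
  fermat {p} pr z = begin
    z ^ p             ≈⟨ ^-cong (x≈x%ℕn z) p ⟩
    (+ r) ^ p         ≡⟨ +-^ r p ⟨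
    + (r ℕ.^ p)       ≡⟨ cong +_ (proj₂ (fermat-ℕ pr r)) ⟩
    + (r ℕ.+ t ℕ.* p) ≡⟨ trans (pos-+ r (t ℕ.* p)) (cong (λ y → + r + y) (pos-* t p)) ⟩
    + r + + t * + p   ≈⟨ x+kn≈x (+ r) (+ t) ⟩
    + r               ≈⟨ ≈-sym (x≈x%ℕn z) ⟩
    z                 ∎
    where
    open Congruence p
    open import Relation.Binary.Reasoning.Setoid ≈-setoid
    instance _ = prime⇒nonZero pr
    r = z %ℕ p
    t = proj₁ (fermat-ℕ pr r)

  euclidsLemmaℤ : ∀ {p} x y → Prime p → + p ∣ x * y → + p ∣ x ⊎ + p ∣ y
  euclidsLemmaℤ {p} x y pr p∣xy =
    Sum.map ∣ᵤ⇒∣ ∣ᵤ⇒∣ (euclidsLemma ℤ.∣ x ∣ ℤ.∣ y ∣ pr (subst (p ℕ.∣_) (abs-* x y) (∣⇒∣ᵤ p∣xy)))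

  prime∣x*x⇒∣x : ∀ {p x} → Prime p → + p ∣ x * x → + p ∣ x
  prime∣x*x⇒∣x {x = x} pr p∣xx = [ id , id ]′ (euclidsLemmaℤ x x pr p∣xx)

  -‿^-odd : ∀ x k → (- x) ^ (1 ℕ.+ k ℕ.* 2) ≡ - (x ^ (1 ℕ.+ k ℕ.* 2))
  -‿^-odd x ℕ.zero    = neg-flip x
    where
    neg-flip : ∀ x → - x * 1ℤ ≡ - (x * 1ℤ)
    neg-flip = solve-∀
  -‿^-odd x (ℕ.suc k) = trans (cong (λ y → - x * (- x * y)) (-‿^-odd x k)) (neg-cube x (x ^ (1 ℕ.+ k ℕ.* 2)))
    where
    neg-cube : ∀ x y → - x * (- x * - y) ≡ - (x * (x * y))
    neg-cube = solve-∀

  ^-double≡*cube^ : ∀ x k → x ^ (2 ℕ.+ k ℕ.* 3) * x ^ (2 ℕ.+ k ℕ.* 3) ≡ x * (x ^ 3) ^ (1 ℕ.+ k ℕ.* 2)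
  ^-double≡*cube^ x k = begin
    x ^ q * x ^ q                   ≡⟨ ^-distribˡ-+-* x q q ⟨
    x ^ (q ℕ.+ q)                   ≡⟨ cong (x ^_) (exponents k) ⟩
    x * x ^ (3 ℕ.* (1 ℕ.+ k ℕ.* 2)) ≡⟨ cong (x *_) (^-*-assoc x 3 (1 ℕ.+ k ℕ.* 2)) ⟨
    x * (x ^ 3) ^ (1 ℕ.+ k ℕ.* 2)   ∎
    where
    open ≡-Reasoning
    q = 2 ℕ.+ k ℕ.* 3
    exponents : ∀ k → (2 ℕ.+ k ℕ.* 3) ℕ.+ (2 ℕ.+ k ℕ.* 3) ≡ 1 ℕ.+ 3 ℕ.* (1 ℕ.+ k ℕ.* 2)
    exponents = ℕ-Solver.solve-∀

  -- q ∣ a³ + b³ = (a + b) N; writing q = 3k + 2, Fermat gives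
  -- a²b ≡ a^(2q) b = a (a³)^(2k+1) b ≡ a (-b³)^(2k+1) b = -a b^(2q) ≡ -ab².
  prime≡2[3]∣normSq⇒∣a*b*[a+b] : ∀ {q} → Prime q → q ℕ.% 3 ≡ 2 → ∀ a b →
    + q ∣ normSq (a , b) → + q ∣ a * b * (a + b)
  prime≡2[3]∣normSq⇒∣a*b*[a+b] {q} pr q%3≡2 a b q∣N =
    subst (+ q ∣_) (factor a b) (∣-diff a²b≈-ab²)
    where
    open Congruence q
    open import Relation.Binary.Reasoning.Setoid ≈-setoid
    k = q ℕ./ 3
    e = 1 ℕ.+ k ℕ.* 2
    q′ = 2 ℕ.+ k ℕ.* 3
    q≡q′ : q ≡ q′
    q≡q′ = trans (ℕ.m≡m%n+[m/n]*n q 3) (cong (ℕ._+ k ℕ.* 3) q%3≡2)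
    fermat′ : ∀ z → z ^ q′ ≈ z
    fermat′ z = subst (λ n → z ^ n ≈ z) q≡q′ (fermat pr z)
    cube-sum : ∀ a b → a * (a * (a * 1ℤ)) - - (b * (b * (b * 1ℤ))) ≡ (a + b) * (a * a - a * b + b * b)
    cube-sum = solve-∀
    a³≈-b³ : a ^ 3 ≈ - (b ^ 3)
    a³≈-b³ = mod (subst (+ q ∣_) (sym (cube-sum a b)) (∣n⇒∣m*n (a + b) q∣N))
    pull-neg : ∀ a b y → a * - y * b ≡ - (a * (b * y))
    pull-neg = solve-∀
    a²b≈-ab² : a * a * b ≈ - (a * (b * b))
    a²b≈-ab² = begin
      a * a * b                 ≈⟨ *-cong (*-cong (≈-sym (fermat′ a)) (≈-sym (fermat′ a))) (≈-refl {b}) ⟩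
      a ^ q′ * a ^ q′ * b       ≡⟨ cong (_* b) (^-double≡*cube^ a k) ⟩
      a * (a ^ 3) ^ e * b       ≈⟨ *-cong (*-cong (≈-refl {a}) (^-cong a³≈-b³ e)) (≈-refl {b}) ⟩
      a * (- (b ^ 3)) ^ e * b   ≡⟨ cong (λ y → a * y * b) (-‿^-odd (b ^ 3) k) ⟩
      a * - ((b ^ 3) ^ e) * b   ≡⟨ pull-neg a b ((b ^ 3) ^ e) ⟩
      - (a * (b * (b ^ 3) ^ e)) ≡⟨ cong (λ y → - (a * y)) (^-double≡*cube^ b k) ⟨
      - (a * (b ^ q′ * b ^ q′)) ≈⟨ -‿cong (*-cong (≈-refl {a}) (*-cong (fermat′ b) (fermat′ b))) ⟩
      - (a * (b * b))           ∎
    factor : ∀ a b → a * a * b - - (a * (b * b)) ≡ a * b * (a + b)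
    factor = solve-∀

  prime[3] : Prime 3
  prime[3] = prime 3-not-composite
    where
    3-not-composite : ¬ Composite 3
    3-not-composite (composite {2} _ 2∣3) = from-no (2 ℕ.∣? 3) 2∣3
    3-not-composite (composite {ℕ.suc (ℕ.suc (ℕ.suc _))} (ℕ.s≤s (ℕ.s≤s (ℕ.s≤s ()))) _)

  %3≡2⇒∤3 : ∀ {q} → q ℕ.% 3 ≡ 2 → ¬ q ℕ.∣ 3
  %3≡2⇒∤3 q%3≡2 q∣3 with prime⇒irreducible prime[3] q∣3
  ... | inj₁ refl with () ← q%3≡2
  ... | inj₂ refl with () ← q%3≡2

  ∣b⇒∣a : ∀ {q} → Prime q → ∀ a b → + q ∣ normSq (a , b) → + q ∣ b → + q ∣ a
  ∣b⇒∣a {q} pr a b q∣N q∣b =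
    prime∣x*x⇒∣x pr (subst (+ q ∣_) (sym (a²-via-b a b)) (∣m∣n⇒∣m+n q∣N (∣m⇒∣m*n (a - b) q∣b)))
    where
    a²-via-b : ∀ a b → a * a ≡ (a * a - a * b + b * b) + b * (a - b)
    a²-via-b = solve-∀

  ∣a+b⇒∣a : ∀ {q} → Prime q → q ℕ.% 3 ≡ 2 → ∀ a b → + q ∣ normSq (a , b) → + q ∣ a + b → + q ∣ a
  ∣a+b⇒∣a {q} pr q%3≡2 a b q∣N q∣a+b =
    [ (λ q∣3 → contradiction (∣⇒∣ᵤ q∣3) (%3≡2⇒∤3 q%3≡2)) , prime∣x*x⇒∣x pr ]′
      (euclidsLemmaℤ (+ 3) (a * a) pr q∣3a²)
    where
    3a²-via-a+b : ∀ a b → + 3 * (a * a) ≡ (a * a - a * b + b * b) + (+ 2 * a - b) * (a + b)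
    3a²-via-a+b = solve-∀
    q∣3a² : + q ∣ + 3 * (a * a)
    q∣3a² = subst (+ q ∣_) (sym (3a²-via-a+b a b)) (∣m∣n⇒∣m+n q∣N (∣n⇒∣m*n (+ 2 * a - b) q∣a+b))

  prime≡2[3]∣normSq⇒∣ : ∀ {q} → Prime q → q ℕ.% 3 ≡ 2 → ∀ a b → + q ∣ normSq (a , b) → + q ∣ a
  prime≡2[3]∣normSq⇒∣ pr q%3≡2 a b q∣N =
    [ [ id , ∣b⇒∣a pr a b q∣N ]′ ∘ euclidsLemmaℤ a b pr , ∣a+b⇒∣a pr q%3≡2 a b q∣N ]′
      (euclidsLemmaℤ (a * b) (a + b) pr (prime≡2[3]∣normSq⇒∣a*b*[a+b] pr q%3≡2 a b q∣N))

  ∣coords⇒²∣norm : ∀ {q n a b} → + n ≡ normSq (a , b) → + q ∣ a → + q ∣ b → q ℕ.* q ℕ.∣ n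
  ∣coords⇒²∣norm {q} {n} n≡N (divides s refl) (divides t refl) = ℕ.divides ℤ.∣ normSq (s , t) ∣ (begin
    n                                        ≡⟨ cong ℤ.∣_∣ n≡N ⟩
    ℤ.∣ normSq (s * + q , t * + q) ∣         ≡⟨ cong ℤ.∣_∣ (normSq-scale s t (+ q)) ⟩
    ℤ.∣ normSq (s , t) * (+ q * + q) ∣       ≡⟨ abs-* (normSq (s , t)) (+ q * + q) ⟩
    ℤ.∣ normSq (s , t) ∣ ℕ.* ℤ.∣ + q * + q ∣ ≡⟨ cong (ℤ.∣ normSq (s , t) ∣ ℕ.*_) (abs-* (+ q) (+ q)) ⟩
    ℤ.∣ normSq (s , t) ∣ ℕ.* (q ℕ.* q)       ∎)
    where
    open ≡-Reasoning
    normSq-scale : ∀ s t x →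
      (s * x) * (s * x) - (s * x) * (t * x) + (t * x) * (t * x) ≡ (s * s - s * t + t * t) * (x * x)
    normSq-scale = solve-∀

  prime≡2[3]∣norm⇒²∣ : ∀ {q n} → Prime q → q ℕ.% 3 ≡ 2 → IsNorm n → q ℕ.∣ n → q ℕ.* q ℕ.∣ n
  prime≡2[3]∣norm⇒²∣ {q} pr q%3≡2 ((a , b) , n≡N) q∣n = ∣coords⇒²∣norm n≡N
    (prime≡2[3]∣normSq⇒∣ pr q%3≡2 a b q∣N)
    (prime≡2[3]∣normSq⇒∣ pr q%3≡2 b a (subst (+ q ∣_) (normSq-swap a b) q∣N))
    where
    q∣N : + q ∣ normSq (a , b)
    q∣N = subst (+ q ∣_) n≡N (∣ᵤ⇒∣ q∣n)
    normSq-swap : ∀ a b → a * a - a * b + b * b ≡ b * b - b * a + a * a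
    normSq-swap = solve-∀

  [a+b]²≡normSq+3ab : ∀ a b → (a + b) * (a + b) ≡ (a * a - a * b + b * b) + a * b * + 3
  [a+b]²≡normSq+3ab = solve-∀

  square≉2[mod3] : ∀ r → r ℕ.< 3 → let open Congruence 3 in ¬ (+ r * + r ≈ + 2)
  square≉2[mod3] 0 _ (Congruence.mod 3∣-2) = from-no (3 ℕ.∣? 2) (∣⇒∣ᵤ 3∣-2)
  square≉2[mod3] 1 _ (Congruence.mod 3∣-1) = from-no (3 ℕ.∣? 1) (∣⇒∣ᵤ 3∣-1)
  square≉2[mod3] 2 _ (Congruence.mod 3∣2)  = from-no (3 ℕ.∣? 2) (∣⇒∣ᵤ 3∣2)
  square≉2[mod3] (ℕ.suc (ℕ.suc (ℕ.suc _))) (ℕ.s≤s (ℕ.s≤s (ℕ.s≤s ())))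

  norm%3≢2 : ∀ {n} → IsNorm n → n ℕ.% 3 ≢ 2
  norm%3≢2 {n} ((a , b) , n≡N) n%3≡2 = square≉2[mod3] r (n%ℕd<d (a + b) 3) (begin
    + r * + r                                     ≈⟨ *-cong (≈-sym (x≈x%ℕn (a + b))) (≈-sym (x≈x%ℕn (a + b))) ⟩
    (a + b) * (a + b)                             ≡⟨ [a+b]²≡normSq+3ab a b ⟩
    (a * a - a * b + b * b) + a * b * + 3         ≈⟨ x+kn≈x (normSq (a , b)) (a * b) ⟩
    normSq (a , b)                                ≡⟨ n≡N ⟨
    + n                                           ≈⟨ x≈x%ℕn (+ n) ⟩
    + (n ℕ.% 3)                                   ≡⟨ cong +_ n%3≡2 ⟩
    + 2                                           ∎)
    where
    open Congruence 3
    open import Relation.Binary.Reasoning.Setoid ≈-setoid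
    r = (a + b) %ℕ 3

  prime-mod3 : ∀ {p} → Prime p → p ≡ 3 ⊎ p ℕ.% 3 ≡ 1 ⊎ p ℕ.% 3 ≡ 2
  prime-mod3 {p} pr with p ℕ.% 3 in p%3 | ℕ.m%n<n p 3
  ... | 0 | _ = inj₁ (sym 3≡p)
    where
    3≡p : 3 ≡ p
    3≡p with prime⇒irreducible pr (ℕ.m%n≡0⇒n∣m p 3 p%3)
    ... | inj₁ ()
    ... | inj₂ 3≡p = 3≡p
  ... | 1 | _ = inj₂ (inj₁ refl)
  ... | 2 | _ = inj₂ (inj₂ refl)
  ... | ℕ.suc (ℕ.suc (ℕ.suc _)) | ℕ.s≤s (ℕ.s≤s (ℕ.s≤s ()))

  prime-norm : ∀ {r} → Prime r → IsNorm r → r ≡ 3 ⊎ r ℕ.% 3 ≡ 1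
  prime-norm pr r-norm with prime-mod3 pr
  ... | inj₁ r≡3          = inj₁ r≡3
  ... | inj₂ (inj₁ r%3≡1) = inj₂ r%3≡1
  ... | inj₂ (inj₂ r%3≡2) = contradiction r%3≡2 (norm%3≢2 r-norm)

module Diagonals where

  open import Data.Nat
  open import Data.Nat.Divisibility
  open import Data.Nat.Primality using (Prime; euclidsLemma; prime⇒nonZero; prime⇒irreducible; prime[2])
  open import Data.Nat.Properties
  open import Data.Nat.Tactic.RingSolver using (solve-∀)
  open import Data.Product using (∃-syntax; _×_; _,_; swap; proj₁)
  open import Data.Sum using (inj₁; inj₂; [_,_]′)
  open import Relation.Binary.PropositionalEquality
  open import Relation.Nullary using (contradiction)
  open import Relation.Nullary.Decidable using (from-no)

  -- u and v stand for the squared lengths of the diagonals c₁ - c₂ and c₁ + c₂ of the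
  -- rhombus spanned by a minimal basis of a sublattice of index J with |Γ| = m.
  RhombusDiagonals : ℕ → ℕ → Set
  RhombusDiagonals J m = ∃[ u ] ∃[ v ] (u * v ≡ 3 * (J * J) × u + v ≡ 4 * m × m ≤ u × m ≤ v)

  Balanced : ℕ → ℕ → Set
  Balanced k l = k ≤ 3 * l × l ≤ 3 * k

  sum≡4m⇒balanced : ∀ {m u v} → u + v ≡ 4 * m → m ≤ u → m ≤ v → Balanced u v
  sum≡4m⇒balanced {m} {u} {v} u+v≡4m m≤u m≤v = bound u+v≡4m m≤v , bound (trans (+-comm v u) u+v≡4m) m≤u
    where
    bound : ∀ {x y} → x + y ≡ 4 * m → m ≤ y → x ≤ 3 * y
    bound {x} {y} x+y≡4m m≤y = +-cancelʳ-≤ y x (3 * y) (begin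
      x + y     ≡⟨ x+y≡4m ⟩
      4 * m     ≤⟨ *-monoʳ-≤ 4 m≤y ⟩
      y + 3 * y ≡⟨ +-comm y (3 * y) ⟩
      3 * y + y ∎)
      where open ≤-Reasoning

  -- k = c P and c l = 3 P with c² ≤ 9, so (k , l) is (P , 3P), (3P , P) or, for P = 2,
  -- (4 , 3); the parity hypothesis rules out the last.
  balanced-prime-∣ˡ : ∀ {P k l} → Prime P → P ∣ k → k * l ≡ 3 * (P * P) → Balanced k l → 2 ∣ k + l →
    k + l ≡ 4 * P
  balanced-prime-∣ˡ {P} {k} {l} pr (divides c refl) kl≡3P² (k≤3l , _) 2∣k+l = by-cofactor c cl≡3P c*c≤9 2∣k+l
    where
    instance _ = prime⇒nonZero pr
    cl≡3P : c * l ≡ 3 * P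
    cl≡3P = *-cancelʳ-≡ (c * l) (3 * P) P (begin
      c * l * P   ≡⟨ swap-last c l P ⟩
      c * P * l   ≡⟨ kl≡3P² ⟩
      3 * (P * P) ≡⟨ *-assoc 3 P P ⟨
      3 * P * P   ∎)
      where
      open ≡-Reasoning
      swap-last : ∀ x y z → x * y * z ≡ x * z * y
      swap-last = solve-∀
    c*c≤9 : c * c ≤ 9
    c*c≤9 = *-cancelʳ-≤ (c * c) 9 P (begin
      c * c * P   ≡⟨ *-assoc c c P ⟩
      c * (c * P) ≤⟨ *-monoʳ-≤ c k≤3l ⟩
      c * (3 * l) ≡⟨ pull-3 c l ⟩
      3 * (c * l) ≡⟨ cong (3 *_) cl≡3P ⟩
      3 * (3 * P) ≡⟨ *-assoc 3 3 P ⟨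
      9 * P       ∎)
      where
      open ≤-Reasoning
      pull-3 : ∀ x y → x * (3 * y) ≡ 3 * (x * y)
      pull-3 = solve-∀
    by-cofactor : ∀ c → c * l ≡ 3 * P → c * c ≤ 9 → 2 ∣ c * P + l → c * P + l ≡ 4 * P
    by-cofactor 0 0≡3P _ _ = contradiction (sym 0≡3P) (≢-nonZero⁻¹ (3 * P) ⦃ m*n≢0 3 P ⦄)
    by-cofactor 1 l+0≡3P _ _ = begin
      1 * P + l     ≡⟨ cong (1 * P +_) (trans (sym (+-identityʳ l)) l+0≡3P) ⟩
      1 * P + 3 * P ≡⟨ *-distribʳ-+ P 1 3 ⟨
      4 * P         ∎
      where open ≡-Reasoning
    by-cofactor 2 2l≡3P _ 2∣2P+l with divides l′ refl ← ∣m+n∣m⇒∣n 2∣2P+l (divides P (*-comm 2 P))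
      with euclidsLemma 3 P prime[2] (divides l (trans (sym 2l≡3P) (*-comm 2 l)))
    ... | inj₁ 2∣3 = contradiction 2∣3 (from-no (2 ∣? 3))
    ... | inj₂ 2∣P with prime⇒irreducible pr 2∣P
    ...   | inj₂ 2≡P = contradiction (subst (λ P → 4 ∣ 3 * P) (sym 2≡P) 4∣3P) (from-no (4 ∣? 6))
      where
      4∣3P : 4 ∣ 3 * P
      4∣3P = divides l′ (trans (sym 2l≡3P) (double-even l′))
        where
        double-even : ∀ x → 2 * (x * 2) ≡ x * 4
        double-even = solve-∀
    by-cofactor 3 3l≡3P _ _ = begin
      3 * P + l     ≡⟨ cong (3 * P +_) (*-cancelˡ-≡ l P 3 3l≡3P) ⟩
      3 * P + P     ≡⟨ +-comm (3 * P) P ⟩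
      4 * P         ∎
      where open ≡-Reasoning
    by-cofactor (suc (suc (suc (suc j)))) _ c*c≤9 _ =
      contradiction c*c≤9 (<⇒≱ (≤-trans (m≤m+n 10 6) (*-mono-≤ (m≤m+n 4 j) (m≤m+n 4 j))))

  balanced-prime : ∀ {P k l} → Prime P → k * l ≡ 3 * (P * P) → Balanced k l → 2 ∣ k + l → k + l ≡ 4 * P
  balanced-prime {P} {k} {l} pr kl≡3P² bal 2∣k+l
    with euclidsLemma k l pr (divides (3 * P) (trans kl≡3P² (sym (*-assoc 3 P P))))
  ... | inj₁ P∣k = balanced-prime-∣ˡ pr P∣k kl≡3P² bal 2∣k+l
  ... | inj₂ P∣l = trans (+-comm k l)
    (balanced-prime-∣ˡ pr P∣l (trans (*-comm l k) kl≡3P²) (swap bal) (subst (2 ∣_) (+-comm k l) 2∣k+l))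

  balanced-prime-scaled : ∀ {P d k l} .{{_ : NonZero d}} → Prime P →
    k * d * (l * d) ≡ 3 * (P * d * (P * d)) → Balanced (k * d) (l * d) → 2 ∣ k + l →
    k * d + l * d ≡ 4 * (P * d)
  balanced-prime-scaled {P} {d} {k} {l} pr kdld≡3[Pd]² (kd≤3ld , ld≤3kd) 2∣k+l = begin
    k * d + l * d ≡⟨ *-distribʳ-+ d k l ⟨
    (k + l) * d   ≡⟨ cong (_* d) (balanced-prime pr kl≡3P² (k≤3l , l≤3k) 2∣k+l) ⟩
    4 * P * d     ≡⟨ *-assoc 4 P d ⟩
    4 * (P * d)   ∎
    where
    open ≡-Reasoning
    instance _ = m*n≢0 d d
    factor-d² : ∀ x y d → x * d * (y * d) ≡ x * y * (d * d)
    factor-d² = solve-∀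
    kl≡3P² : k * l ≡ 3 * (P * P)
    kl≡3P² = *-cancelʳ-≡ (k * l) (3 * (P * P)) (d * d)
      (trans (sym (factor-d² k l d))
        (trans kdld≡3[Pd]² (trans (cong (3 *_) (factor-d² P P d)) (sym (*-assoc 3 (P * P) (d * d))))))
    cancel-d : ∀ x y → x * d ≤ 3 * (y * d) → x ≤ 3 * y
    cancel-d x y xd≤3yd = *-cancelʳ-≤ x (3 * y) d (subst (x * d ≤_) (sym (*-assoc 3 y d)) xd≤3yd)
    k≤3l = cancel-d k l kd≤3ld
    l≤3k = cancel-d l k ld≤3kd

  q²∣u⇒q²≤[3p]² : ∀ {p q k v} .{{_ : NonZero p}} .{{_ : NonZero q}} →
    k * q * q * v ≡ 3 * (p * q * (p * q)) → k * q * q ≤ 3 * v → q * q ≤ 3 * p * (3 * p)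
  q²∣u⇒q²≤[3p]² {p} {q} {k} {v} kqqv≡3[pq]² kqq≤3v = begin
    q * q               ≤⟨ m≤n*m (q * q) (k * k) ⟩
    k * k * (q * q)     ≡⟨ regroup-k k q ⟩
    k * (k * q * q)     ≤⟨ *-monoʳ-≤ k kqq≤3v ⟩
    k * (3 * v)         ≡⟨ pull-3 k v ⟩
    3 * (k * v)         ≡⟨ cong (3 *_) kv≡3p² ⟩
    3 * (3 * (p * p))   ≡⟨ regroup-p p ⟩
    3 * p * (3 * p)     ∎
    where
    open ≤-Reasoning
    instance _ = m*n≢0 q q
    kv≡3p² : k * v ≡ 3 * (p * p)
    kv≡3p² = *-cancelʳ-≡ (k * v) (3 * (p * p)) (q * q) (trans (regroup-kv k q v) (trans kqqv≡3[pq]² (regroup-pq p q)))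
      where
      regroup-kv : ∀ k q v → k * v * (q * q) ≡ k * q * q * v
      regroup-kv = solve-∀
      regroup-pq : ∀ p q → 3 * (p * q * (p * q)) ≡ 3 * (p * p) * (q * q)
      regroup-pq = solve-∀
    instance
      k≢0 : NonZero k
      k≢0 = m*n≢0⇒m≢0 k ⦃ subst NonZero (sym kv≡3p²) (m*n≢0 3 (p * p) ⦃ _ ⦄ ⦃ m*n≢0 p p ⦄) ⦄
      k*k≢0 : NonZero (k * k)
      k*k≢0 = m*n≢0 k k
    regroup-k : ∀ k q → k * k * (q * q) ≡ k * (k * q * q)
    regroup-k = solve-∀
    pull-3 : ∀ x y → x * (3 * y) ≡ 3 * (x * y)
    pull-3 = solve-∀
    regroup-p : ∀ p → 3 * (3 * (p * p)) ≡ 3 * p * (3 * p)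
    regroup-p = solve-∀

  balanced-pq-∣ˡ : ∀ {p q u v} → Prime p → Prime q → q % 2 ≡ 1 → 3 * p < q → q ∣ u →
    u * v ≡ 3 * (p * q * (p * q)) → Balanced u v → 2 ∣ u + v → u + v ≡ 4 * (p * q)
  balanced-pq-∣ˡ {p} {q} {u} {v} prp prq q%2≡1 3p<q (divides k refl) uv≡3[pq]² bal 2∣u+v
    with euclidsLemma k v prq (divides (3 * (p * p)) kv≡3p²q)
    where
    instance _ = prime⇒nonZero prq
    kv≡3p²q : k * v ≡ 3 * (p * p) * q
    kv≡3p²q = *-cancelʳ-≡ (k * v) (3 * (p * p) * q) q (trans (swap-last k v q) (trans uv≡3[pq]² (regroup p q)))
      where
      swap-last : ∀ x y z → x * y * z ≡ x * z * y
      swap-last = solve-∀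
      regroup : ∀ p q → 3 * (p * q * (p * q)) ≡ 3 * (p * p) * q * q
      regroup = solve-∀
  ... | inj₁ (divides k′ refl) = contradiction (*-mono-< 3p<q 3p<q)
    (≤⇒≯ (q²∣u⇒q²≤[3p]² {k = k′} {v = v} ⦃ prime⇒nonZero prp ⦄ ⦃ prime⇒nonZero prq ⦄
      uv≡3[pq]² (proj₁ bal)))
  ... | inj₂ (divides l refl) = balanced-prime-scaled {k = k} {l = l} ⦃ prime⇒nonZero prq ⦄ prp uv≡3[pq]² bal 2∣k+l
    where
    instance _ = prime⇒nonZero prq
    2∣k+l : 2 ∣ k + l
    2∣k+l with euclidsLemma (k + l) q prime[2] (subst (2 ∣_) (sym (*-distribʳ-+ q k l)) 2∣u+v)
    ... | inj₁ 2∣k+l = 2∣k+l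
    ... | inj₂ 2∣q   = contradiction (trans (sym (n∣m⇒m%n≡0 q 2 2∣q)) q%2≡1) (λ ())

  balanced-pq : ∀ {p q u v} → Prime p → Prime q → q % 2 ≡ 1 → 3 * p < q →
    u * v ≡ 3 * (p * q * (p * q)) → Balanced u v → 2 ∣ u + v → u + v ≡ 4 * (p * q)
  balanced-pq {p} {q} {u} {v} prp prq q%2≡1 3p<q uv≡3[pq]² bal 2∣u+v
    with euclidsLemma u v prq (divides (3 * (p * p) * q) (trans uv≡3[pq]² (regroup p q)))
    where
    regroup : ∀ p q → 3 * (p * q * (p * q)) ≡ 3 * (p * p) * q * q
    regroup = solve-∀
  ... | inj₁ q∣u = balanced-pq-∣ˡ prp prq q%2≡1 3p<q q∣u uv≡3[pq]² bal 2∣u+v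
  ... | inj₂ q∣v = trans (+-comm u v) (balanced-pq-∣ˡ prp prq q%2≡1 3p<q q∣v
    (trans (*-comm v u) uv≡3[pq]²) (swap bal) (subst (2 ∣_) (+-comm u v) 2∣u+v))

  balanced-2p : ∀ {p u v} → Prime p → u * v ≡ 3 * (2 * p * (2 * p)) → Balanced u v → 4 ∣ u + v →
    u + v ≡ 4 * (2 * p)
  balanced-2p {p} {u} {v} prp uv≡3[2p]² bal 4∣u+v =
    [ (λ 2∣u → both-even 2∣u (∣m+n∣m⇒∣n 2∣u+v 2∣u))
    , (λ 2∣v → both-even (∣m+n∣m⇒∣n (subst (2 ∣_) (+-comm u v) 2∣u+v) 2∣v) 2∣v)
    ]′ (euclidsLemma u v prime[2] (divides (6 * (p * p)) (trans uv≡3[2p]² (regroup p))))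
    where
    regroup : ∀ p → 3 * (2 * p * (2 * p)) ≡ 6 * (p * p) * 2
    regroup = solve-∀
    2∣u+v : 2 ∣ u + v
    2∣u+v = ∣-trans (divides 2 refl) 4∣u+v
    both-even : 2 ∣ u → 2 ∣ v → u + v ≡ 4 * (2 * p)
    both-even (divides k refl) (divides l refl) = begin
      k * 2 + l * 2 ≡⟨ balanced-prime-scaled {k = k} {l = l} prp (trans uv≡3[2p]² (commute-2 p)) bal 2∣k+l ⟩
      4 * (p * 2)   ≡⟨ cong (4 *_) (*-comm p 2) ⟩
      4 * (2 * p)   ∎
      where
      open ≡-Reasoning
      commute-2 : ∀ p → 3 * (2 * p * (2 * p)) ≡ 3 * (p * 2 * (p * 2))
      commute-2 = solve-∀
      2∣k+l : 2 ∣ k + l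
      2∣k+l = *-cancelʳ-∣ 2 (subst (2 * 2 ∣_) (sym (*-distribʳ-+ 2 k l)) 4∣u+v)

module Geometry where

  open import Data.Integer hiding (_⊖_)
  open import Data.Integer.Properties
  open import Data.Integer.Tactic.RingSolver using (solve-∀)
  import Data.Nat as ℕ
  import Data.Nat.Divisibility as ℕ
  open import Data.Product using (∃-syntax; _×_; _,_)
  open import Relation.Binary.PropositionalEquality
  open Norm using (IsNorm)
  open Diagonals using (RhombusDiagonals)

  infixl 6 _⊕_ _⊖_
  _⊕_ : Pt → Pt → Pt
  (a , b) ⊕ (c , d) = (a + c , b + d)

  _⊖_ : Pt → Pt → Pt
  (a , b) ⊖ (c , d) = (a - c , b - d)

  lin-⊕ : ∀ e f e′ f′ u v → lin e f u v ⊕ lin e′ f′ u v ≡ lin (e + e′) (f + f′) u v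
  lin-⊕ e f e′ f′ (u₁ , u₂) (v₁ , v₂) = cong₂ _,_ (collect e f e′ f′ u₁ v₁) (collect e f e′ f′ u₂ v₂)
    where
    collect : ∀ e f e′ f′ x y → (e * x + f * y) + (e′ * x + f′ * y) ≡ (e + e′) * x + (f + f′) * y
    collect = solve-∀

  lin-⊖ : ∀ e f e′ f′ u v → lin e f u v ⊖ lin e′ f′ u v ≡ lin (e - e′) (f - f′) u v
  lin-⊖ e f e′ f′ (u₁ , u₂) (v₁ , v₂) = cong₂ _,_ (collect e f e′ f′ u₁ v₁) (collect e f e′ f′ u₂ v₂)
    where
    collect : ∀ e f e′ f′ x y → (e * x + f * y) - (e′ * x + f′ * y) ≡ (e - e′) * x + (f - f′) * y
    collect = solve-∀

  ∈Γ-⊕ : ∀ {Γ w₁ w₂} → w₁ ∈Γ Γ → w₂ ∈Γ Γ → (w₁ ⊕ w₂) ∈Γ Γ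
  ∈Γ-⊕ {Γ} (e , f , refl) (e′ , f′ , refl) = e + e′ , f + f′ , lin-⊕ e f e′ f′ (b₁ Γ) (b₂ Γ)

  ∈Γ-⊖ : ∀ {Γ w₁ w₂} → w₁ ∈Γ Γ → w₂ ∈Γ Γ → (w₁ ⊖ w₂) ∈Γ Γ
  ∈Γ-⊖ {Γ} (e , f , refl) (e′ , f′ , refl) = e - e′ , f - f′ , lin-⊖ e f e′ f′ (b₁ Γ) (b₂ Γ)

  det₂-zeroʳ : ∀ u → det₂ u zeroPt ≡ 0ℤ
  det₂-zeroʳ (a , b) = identity a b
    where
    identity : ∀ a b → a * 0ℤ - b * 0ℤ ≡ 0ℤ
    identity = solve-∀

  det₂-⊕ʳ : ∀ u v → det₂ u (u ⊕ v) ≡ det₂ u v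
  det₂-⊕ʳ (a , b) (c , d) = identity a b c d
    where
    identity : ∀ a b c d → a * (b + d) - b * (a + c) ≡ a * d - b * c
    identity = solve-∀

  det₂-⊖ʳ : ∀ u v → det₂ u (u ⊖ v) ≡ - det₂ u v
  det₂-⊖ʳ (a , b) (c , d) = identity a b c d
    where
    identity : ∀ a b c d → a * (b - d) - b * (a - c) ≡ - (a * d - b * c)
    identity = solve-∀

  ⊕-≢zeroPt : ∀ u v → det₂ u v ≢ 0ℤ → u ⊕ v ≢ zeroPt
  ⊕-≢zeroPt u v det≢0 u⊕v≡0 = det≢0 (begin
    det₂ u v        ≡⟨ det₂-⊕ʳ u v ⟨
    det₂ u (u ⊕ v)  ≡⟨ cong (det₂ u) u⊕v≡0 ⟩
    det₂ u zeroPt   ≡⟨ det₂-zeroʳ u ⟩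
    0ℤ              ∎)
    where open ≡-Reasoning

  ⊖-≢zeroPt : ∀ u v → det₂ u v ≢ 0ℤ → u ⊖ v ≢ zeroPt
  ⊖-≢zeroPt u v det≢0 u⊖v≡0 = det≢0 (begin
    det₂ u v            ≡⟨ neg-involutive (det₂ u v) ⟨
    - - det₂ u v        ≡⟨ cong -_ (det₂-⊖ʳ u v) ⟨
    - det₂ u (u ⊖ v)    ≡⟨ cong (λ w → - det₂ u w) u⊖v≡0 ⟩
    - det₂ u zeroPt     ≡⟨ cong -_ (det₂-zeroʳ u) ⟩
    0ℤ                  ∎)
    where open ≡-Reasoning

  parallelogram : ∀ u v → normSq (u ⊖ v) + normSq (u ⊕ v) ≡ + 2 * normSq u + + 2 * normSq v
  parallelogram (a , b) (c , d) = identity a b c d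
    where
    identity : ∀ a b c d →
      ((a - c) * (a - c) - (a - c) * (b - d) + (b - d) * (b - d))
      + ((a + c) * (a + c) - (a + c) * (b + d) + (b + d) * (b + d))
      ≡ + 2 * (a * a - a * b + b * b) + + 2 * (c * c - c * d + d * d)
    identity = solve-∀

  diagonals-product : ∀ u v → normSq (u ⊖ v) * normSq (u ⊕ v)
    ≡ + 3 * (det₂ u v * det₂ u v) + (normSq u - normSq v) * (normSq u - normSq v)
  diagonals-product (a , b) (c , d) = identity a b c d
    where
    identity : ∀ a b c d →
      ((a - c) * (a - c) - (a - c) * (b - d) + (b - d) * (b - d))
      * ((a + c) * (a + c) - (a + c) * (b + d) + (b + d) * (b + d))
      ≡ + 3 * ((a * d - b * c) * (a * d - b * c))
        + ((a * a - a * b + b * b) - (c * c - c * d + d * d)) * ((a * a - a * b + b * b) - (c * c - c * d + d * d))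
    identity = solve-∀

  square-nonneg : ∀ i → 0ℤ ≤ i * i
  square-nonneg (+ n)    = subst (0ℤ ≤_) (pos-* n n) (+≤+ ℕ.z≤n)
  square-nonneg -[1+ n ] = subst (0ℤ ≤_) (trans (pos-* (ℕ.suc n) (ℕ.suc n)) (neg-square (+ ℕ.suc n))) (+≤+ ℕ.z≤n)
    where
    neg-square : ∀ x → x * x ≡ - x * - x
    neg-square = solve-∀

  normSq-nonneg : ∀ w → 0ℤ ≤ normSq w
  normSq-nonneg (a , b) = *-cancelˡ-≤-pos 0ℤ (normSq (a , b)) (+ 4) (subst (0ℤ ≤_) (sym (four-normSq a b))
    (+-mono-≤ (square-nonneg (+ 2 * a - b))
      (+-mono-≤ (square-nonneg b) (+-mono-≤ (square-nonneg b) (square-nonneg b)))))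
    where
    four-normSq : ∀ a b →
      + 4 * (a * a - a * b + b * b) ≡ (+ 2 * a - b) * (+ 2 * a - b) + (b * b + (b * b + b * b))
    four-normSq = solve-∀

  det₂-lin : ∀ x y x′ y′ u v → det₂ (lin x y u v) (lin x′ y′ u v) ≡ (x * y′ - y * x′) * det₂ u v
  det₂-lin x y x′ y′ (u₁ , u₂) (v₁ , v₂) = identity x y x′ y′ u₁ u₂ v₁ v₂
    where
    identity : ∀ x y x′ y′ u₁ u₂ v₁ v₂ →
      (x * u₁ + y * v₁) * (x′ * u₂ + y′ * v₂) - (x * u₂ + y * v₂) * (x′ * u₁ + y′ * v₁)
      ≡ (x * y′ - y * x′) * (u₁ * v₂ - u₂ * v₁)
    identity = solve-∀

  det₂-∣-det₂-lin : ∀ {w₁ w₂} u v → (∃[ x ] ∃[ y ] w₁ ≡ lin x y u v) → (∃[ x ] ∃[ y ] w₂ ≡ lin x y u v) →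
    ∣ det₂ u v ∣ ℕ.∣ ∣ det₂ w₁ w₂ ∣
  det₂-∣-det₂-lin u v (x , y , refl) (x′ , y′ , refl) = ℕ.divides ∣ x * y′ - y * x′ ∣
    (trans (cong ∣_∣ (det₂-lin x y x′ y′ u v)) (abs-* (x * y′ - y * x′) (det₂ u v)))

  b₁∈Γ : ∀ Γ → b₁ Γ ∈Γ Γ
  b₁∈Γ Γ = 1ℤ , 0ℤ , lin-1-0 (b₁ Γ) (b₂ Γ)
    where
    lin-1-0 : ∀ u v → u ≡ lin 1ℤ 0ℤ u v
    lin-1-0 (u₁ , u₂) (v₁ , v₂) = cong₂ _,_ (identity u₁ v₁) (identity u₂ v₂)
      where
      identity : ∀ u v → u ≡ 1ℤ * u + 0ℤ * v
      identity = solve-∀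

  b₂∈Γ : ∀ Γ → b₂ Γ ∈Γ Γ
  b₂∈Γ Γ = 0ℤ , 1ℤ , lin-0-1 (b₁ Γ) (b₂ Γ)
    where
    lin-0-1 : ∀ u v → v ≡ lin 0ℤ 1ℤ u v
    lin-0-1 (u₁ , u₂) (v₁ , v₂) = cong₂ _,_ (identity u₁ v₁) (identity u₂ v₂)
      where
      identity : ∀ u v → v ≡ 0ℤ * u + 1ℤ * v
      identity = solve-∀

  basis⇒∣det₂∣≡index : ∀ {c₁ c₂ Γ} → IsBasisOf c₁ c₂ Γ → ∣ det₂ c₁ c₂ ∣ ≡ index Γ
  basis⇒∣det₂∣≡index {c₁} {c₂} {Γ} (c₁∈Γ , c₂∈Γ , _ , spans) = ℕ.∣-antisym
    (det₂-∣-det₂-lin {b₁ Γ} {b₂ Γ} c₁ c₂ (spans (b₁ Γ) (b₁∈Γ Γ)) (spans (b₂ Γ) (b₂∈Γ Γ)))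
    (det₂-∣-det₂-lin {c₁} {c₂} (b₁ Γ) (b₂ Γ) c₁∈Γ c₂∈Γ)

  rhombus-sum : ∀ u v → normSq u ≡ normSq v → normSq (u ⊖ v) + normSq (u ⊕ v) ≡ + 4 * normSq u
  rhombus-sum u v Nu≡Nv = begin
    normSq (u ⊖ v) + normSq (u ⊕ v) ≡⟨ parallelogram u v ⟩
    + 2 * Nu + + 2 * normSq v       ≡⟨ cong (λ N → + 2 * Nu + + 2 * N) Nu≡Nv ⟨
    + 2 * Nu + + 2 * Nu             ≡⟨ *-distribʳ-+ Nu (+ 2) (+ 2) ⟨
    + 4 * Nu                        ∎
    where
    open ≡-Reasoning
    Nu = normSq u

  rhombus-product : ∀ u v → normSq u ≡ normSq v →
    normSq (u ⊖ v) * normSq (u ⊕ v) ≡ + 3 * (det₂ u v * det₂ u v)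
  rhombus-product u v Nu≡Nv = begin
    normSq (u ⊖ v) * normSq (u ⊕ v)               ≡⟨ diagonals-product u v ⟩
    + 3 * (D * D) + (Nu - normSq v) * (Nu - normSq v) ≡⟨ cong (λ N → + 3 * (D * D) + (Nu - N) * (Nu - N)) Nu≡Nv ⟨
    + 3 * (D * D) + (Nu - Nu) * (Nu - Nu)         ≡⟨ cong (λ z → + 3 * (D * D) + z * z) (+-inverseʳ Nu) ⟩
    + 3 * (D * D) + 0ℤ                            ≡⟨ +-identityʳ (+ 3 * (D * D)) ⟩
    + 3 * (D * D)                                 ∎
    where
    open ≡-Reasoning
    Nu = normSq u
    D = det₂ u v

  wellRounded⇒rhombus : ∀ Γ → WellRounded Γ → ∃[ m ] (IsNorm m × RhombusDiagonals (index Γ) m)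
  wellRounded⇒rhombus Γ (c₁ , c₂ , basis@(c₁∈Γ , c₂∈Γ , det≢0 , _) , N₁≡N₂ , _ , minimal) =
    m , (c₁ , +m≡M) , u , v , uv≡3J² , u+v≡4m , drop‿+≤+ +m≤+u , drop‿+≤+ +m≤+v
    where
    M = normSq c₁
    U = normSq (c₁ ⊖ c₂)
    V = normSq (c₁ ⊕ c₂)
    D = det₂ c₁ c₂
    M≤U : M ≤ U
    M≤U = minimal (c₁ ⊖ c₂) (∈Γ-⊖ {Γ} c₁∈Γ c₂∈Γ) (⊖-≢zeroPt c₁ c₂ det≢0)
    M≤V : M ≤ V
    M≤V = minimal (c₁ ⊕ c₂) (∈Γ-⊕ {Γ} c₁∈Γ c₂∈Γ) (⊕-≢zeroPt c₁ c₂ det≢0)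
    m u v : ℕ
    m = ∣ M ∣
    u = ∣ U ∣
    v = ∣ V ∣
    +m≡M : + m ≡ M
    +m≡M = 0≤i⇒+∣i∣≡i (normSq-nonneg c₁)
    +u≡U : + u ≡ U
    +u≡U = 0≤i⇒+∣i∣≡i (≤-trans (normSq-nonneg c₁) M≤U)
    +v≡V : + v ≡ V
    +v≡V = 0≤i⇒+∣i∣≡i (≤-trans (normSq-nonneg c₁) M≤V)
    +m≤+u : + m ≤ + u
    +m≤+u = subst₂ _≤_ (sym +m≡M) (sym +u≡U) M≤U
    +m≤+v : + m ≤ + v
    +m≤+v = subst₂ _≤_ (sym +m≡M) (sym +v≡V) M≤V
    u+v≡4m : u ℕ.+ v ≡ 4 ℕ.* m
    u+v≡4m = +-injective (begin
      + (u ℕ.+ v) ≡⟨ trans (pos-+ u v) (cong₂ _+_ +u≡U +v≡V) ⟩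
      U + V       ≡⟨ rhombus-sum c₁ c₂ N₁≡N₂ ⟩
      + 4 * M     ≡⟨ trans (cong (+ 4 *_) (sym +m≡M)) (sym (pos-* 4 m)) ⟩
      + (4 ℕ.* m) ∎)
      where open ≡-Reasoning
    uv≡3J² : u ℕ.* v ≡ 3 ℕ.* (index Γ ℕ.* index Γ)
    uv≡3J² = begin
      u ℕ.* v                     ≡⟨ abs-* U V ⟨
      ∣ U * V ∣                   ≡⟨ cong ∣_∣ (rhombus-product c₁ c₂ N₁≡N₂) ⟩
      ∣ + 3 * (D * D) ∣           ≡⟨ abs-* (+ 3) (D * D) ⟩
      3 ℕ.* ∣ D * D ∣             ≡⟨ cong (3 ℕ.*_) (abs-* D D) ⟩
      3 ℕ.* (∣ D ∣ ℕ.* ∣ D ∣)     ≡⟨ cong (λ J → 3 ℕ.* (J ℕ.* J)) (basis⇒∣det₂∣≡index {c₁} {c₂} {Γ} basis) ⟩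
      3 ℕ.* (index Γ ℕ.* index Γ) ∎
      where open ≡-Reasoning

module NormalForm where

  open import Data.List using ([]; _∷_; _++_)
  open import Data.List.Relation.Unary.All using ([]; _∷_)
  open import Data.List.Relation.Unary.All.Properties using (++⁺)
  open import Data.Nat
  open import Data.Nat.ListAction using (product)
  open import Data.Nat.ListAction.Properties using (product-++)
  open import Data.Nat.Primality using (Prime)
  open import Data.Nat.Properties using (^-distribˡ-+-*)
  open import Data.Nat.Tactic.RingSolver using (solve-∀)
  open import Data.Product using (_,_)
  open import Relation.Binary.PropositionalEquality

  normForm-3 : NormForm 3
  normForm-3 = 1 , [] , [] , [] , [] , refl

  normForm-prime : ∀ {p} → Prime p → p % 3 ≡ 1 → NormForm p
  normForm-prime {p} pr p%3≡1 = 0 , p ∷ [] , [] , (pr , p%3≡1) ∷ [] , [] , unit p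
    where
    unit : ∀ p → p ≡ 1 * (p * 1) * (1 * 1)
    unit = solve-∀

  normForm-* : ∀ {m n} → NormForm m → NormForm n → NormForm (m * n)
  normForm-* (k , ps , qs , ps-ok , qs-ok , refl) (k′ , ps′ , qs′ , ps′-ok , qs′-ok , refl) =
    k + k′ , ps ++ ps′ , qs ++ qs′ , ++⁺ ps-ok ps′-ok , ++⁺ qs-ok qs′-ok , (begin
      3 ^ k * P * (Q * Q) * (3 ^ k′ * P′ * (Q′ * Q′))        ≡⟨ regroup (3 ^ k) (3 ^ k′) P P′ Q Q′ ⟩
      3 ^ k * 3 ^ k′ * (P * P′) * ((Q * Q′) * (Q * Q′))
        ≡⟨ cong₂ (λ a b → a * (P * P′) * (b * b)) (^-distribˡ-+-* 3 k k′) (product-++ qs qs′) ⟨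
      3 ^ (k + k′) * (P * P′) * (product (qs ++ qs′) * product (qs ++ qs′))
        ≡⟨ cong (λ a → 3 ^ (k + k′) * a * (product (qs ++ qs′) * product (qs ++ qs′))) (product-++ ps ps′) ⟨
      3 ^ (k + k′) * product (ps ++ ps′) * (product (qs ++ qs′) * product (qs ++ qs′)) ∎)
    where
    open ≡-Reasoning
    P = product ps
    P′ = product ps′
    Q = product qs
    Q′ = product qs′
    regroup : ∀ t t′ P P′ Q Q′ →
      t * P * (Q * Q) * (t′ * P′ * (Q′ * Q′)) ≡ t * t′ * (P * P′) * ((Q * Q′) * (Q * Q′))
    regroup = solve-∀

open import Data.Nat using (_%_; _*_; _+_; _≤_)
open import Data.Nat.Divisibility using (_∣_; divides; ∣-trans; ∣⇒≤; *-cancelˡ-∣; *-cancelʳ-∣; n∣m⇒m%n≡0)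
open import Data.Nat.DivMod using (%-distribˡ-*)
open import Data.Nat.Primality using (Prime; prime[2]; prime⇒nonZero)
open import Data.Nat.Properties using (<⇒≱; m≤m*n; m≤n*m; *-cancelˡ-≡; *-comm; ≤-<-trans)
open import Data.Product using (_,_)
open import Data.Sum using (inj₁; inj₂)
open import Relation.Binary.PropositionalEquality using (refl; sym; trans; subst; cong₂)
open import Relation.Nullary using (contradiction)
open Norm using (IsNorm; prime-mod3; prime-norm; norm%3≢2; prime≡2[3]∣norm⇒²∣)
open Diagonals using (Balanced; RhombusDiagonals; sum≡4m⇒balanced; balanced-prime; balanced-pq; balanced-2p)
open Geometry using (wellRounded⇒rhombus)
open NormalForm using (normForm-3; normForm-prime; normForm-*)

diagonal-sum≡4J : ∀ {J u v} → CaseHyp J → u * v ≡ 3 * (J * J) → Balanced u v → 4 ∣ u + v → u + v ≡ 4 * J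
diagonal-sum≡4J (inj₁ prJ) uv≡3J² bal 4∣u+v = balanced-prime prJ uv≡3J² bal (∣-trans (divides 2 refl) 4∣u+v)
diagonal-sum≡4J (inj₂ (inj₁ (p , q , (prp , _) , (prq , q%2≡1) , 3p<q , refl))) uv≡3J² bal 4∣u+v =
  balanced-pq prp prq q%2≡1 3p<q uv≡3J² bal (∣-trans (divides 2 refl) 4∣u+v)
diagonal-sum≡4J (inj₂ (inj₂ (p , (prp , _) , refl))) uv≡3J² bal 4∣u+v = balanced-2p prp uv≡3J² bal 4∣u+v

rhombus⇒≡index : ∀ {J m} → CaseHyp J → RhombusDiagonals J m → m ≡ J
rhombus⇒≡index {J} {m} hyp (u , v , uv≡3J² , u+v≡4m , m≤u , m≤v) = *-cancelˡ-≡ m J 4 (trans (sym u+v≡4m)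
  (diagonal-sum≡4J hyp uv≡3J² (sum≡4m⇒balanced u+v≡4m m≤u m≤v) (divides m (trans u+v≡4m (*-comm 4 m)))))

prime-norm⇒normForm : ∀ {r} → Prime r → IsNorm r → NormForm r
prime-norm⇒normForm pr r-norm with prime-norm pr r-norm
... | inj₁ refl  = normForm-3
... | inj₂ r%3≡1 = normForm-prime pr r%3≡1

pq-norm⇒normForm : ∀ {p q} → Prime p → Prime q → 3 * p < q → IsNorm (p * q) → NormForm (p * q)
pq-norm⇒normForm {p} {q} prp prq 3p<q pq-norm with prime-mod3 prq
... | inj₁ refl = contradiction (m≤m*n 3 p ⦃ prime⇒nonZero prp ⦄) (<⇒≱ 3p<q)
... | inj₂ (inj₂ q%3≡2) = contradiction q≤p (<⇒≱ (≤-<-trans (m≤n*m p 3) 3p<q))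
  where
  q≤p : q ≤ p
  q≤p = ∣⇒≤ ⦃ prime⇒nonZero prp ⦄ (*-cancelʳ-∣ q ⦃ prime⇒nonZero prq ⦄
    (prime≡2[3]∣norm⇒²∣ prq q%3≡2 pq-norm (divides p refl)))
... | inj₂ (inj₁ q%3≡1) = normForm-* p-normForm (normForm-prime prq q%3≡1)
  where
  p-normForm : NormForm p
  p-normForm with prime-mod3 prp
  ... | inj₁ refl         = normForm-3
  ... | inj₂ (inj₁ p%3≡1) = normForm-prime prp p%3≡1
  ... | inj₂ (inj₂ p%3≡2) = contradiction (trans (%-distribˡ-* p q 3) (cong₂ (λ a b → (a * b) % 3) p%3≡2 q%3≡1))
                                          (norm%3≢2 pq-norm)

2p-not-norm : ∀ {p} → p % 2 ≡ 1 → ¬ IsNorm (2 * p)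
2p-not-norm {p} p%2≡1 2p-norm = contradiction (trans (sym (n∣m⇒m%n≡0 p 2 2∣p)) p%2≡1) λ ()
  where
  2∣p : 2 ∣ p
  2∣p = *-cancelˡ-∣ 2 (prime≡2[3]∣norm⇒²∣ prime[2] refl 2p-norm (divides p (*-comm 2 p)))

caseHyp∧norm⇒normForm : ∀ {J} → CaseHyp J → IsNorm J → NormForm J
caseHyp∧norm⇒normForm (inj₁ prJ) = prime-norm⇒normForm prJ
caseHyp∧norm⇒normForm (inj₂ (inj₁ (p , q , (prp , _) , (prq , _) , 3p<q , refl))) = pq-norm⇒normForm prp prq 3p<q
caseHyp∧norm⇒normForm (inj₂ (inj₂ (p , (_ , p%2≡1) , refl))) 2p-norm =
  contradiction 2p-norm (2p-not-norm {p} p%2≡1)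

-- J > 0 holds automatically: the index of a sublattice is nonzero.
lemma5p4 : (J : ℕ) → 0 < J → ¬ NormForm J → CaseHyp J →
    (Γ : Sublattice) → index Γ ≡ J → ¬ WellRounded Γ
lemma5p4 J _ ¬normForm hyp Γ refl wellRounded =
  let m , m-norm , rhombus = wellRounded⇒rhombus Γ wellRounded
  in ¬normForm (caseHyp∧norm⇒normForm hyp (subst IsNorm (rhombus⇒≡index hyp rhombus) m-norm))
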